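{- Let $H$ be a graph and $X$ a graph with at least one vertex. Then the corona $G=H\circ X$ is a König–Egerváry graph if and only if $X$ is a König–Egerváry graph without a perfect matching.
   Context: All graphs are finite, simple and undirected. $n(G)$, $\alpha(G)$, $\mu(G)$ denote the number of vertices, independence number and maximum matching size. A graph $G$ is König–Egerváry if $\alpha(G)+\mu(G)=n(G)$. The corona $H\circ X$ is obtained from $H$ by taking, for each vertex $v$ of $H$, a disjoint copy of $X$ and joining $v$ to all vertices of that copy. -}

module Defs where

open import Data.Nat using (ℕ; zero; suc; _+_; _*_; _≤_)
open import Data.Bool using (Bool; true; false; _∧_)
open import Data.Bool.Properties using (∧-zeroʳ)
open import Data.Fin using (Fin; splitAt; remQuot; _≟_)
open import Data.Fin.Subset using (Subset; _∈_; ∣_∣)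
open import Data.List using (List; []; _∷_; length; concatMap)
open import Data.List.Relation.Unary.All using (All)
open import Data.List.Relation.Unary.Any using (Any)
open import Data.List.Relation.Unary.Unique.Propositional using (Unique)
open import Data.Product using (_×_; _,_; ∃; ∃-syntax; Σ-syntax)
open import Data.Sum using (_⊎_; inj₁; inj₂)
open import Relation.Nullary using (does; yes; no)
open import Relation.Binary.PropositionalEquality using (_≡_; refl; sym)

record Graph : Set where
  field
    n      : ℕ
    adj    : Fin n → Fin n → Bool
    adj-sym    : ∀ u v → adj u v ≡ adj v u
    adj-irrefl : ∀ u → adj u u ≡ false
open Graph public

Adj : (G : Graph) → Fin (n G) → Fin (n G) → Set
Adj G u v = adj G u v ≡ true

Independent : (G : Graph) → Subset (n G) → Set
Independent G S = ∀ u v → u ∈ S → v ∈ S → adj G u v ≡ false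

IsIndependenceNumber : (G : Graph) → ℕ → Set
IsIndependenceNumber G k =
  (∃[ S ] (Independent G S × ∣ S ∣ ≡ k)) ×
  (∀ S → Independent G S → ∣ S ∣ ≤ k)

endpoints : ∀ {m} → List (Fin m × Fin m) → List (Fin m)
endpoints = concatMap (λ { (u , v) → u ∷ v ∷ [] })

IsMatching : (G : Graph) → List (Fin (n G) × Fin (n G)) → Set
IsMatching G M = All (λ { (u , v) → Adj G u v }) M × Unique (endpoints M)

IsMatchingNumber : (G : Graph) → ℕ → Set
IsMatchingNumber G k =
  (∃[ M ] (IsMatching G M × length M ≡ k)) ×
  (∀ M → IsMatching G M → length M ≤ k)

KönigEgerváry : Graph → Set
KönigEgerváry G =
  ∃[ a ] ∃[ m ] (IsIndependenceNumber G a × IsMatchingNumber G m × a + m ≡ n G)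

HasPerfectMatching : Graph → Set
HasPerfectMatching G =
  ∃[ M ] (IsMatching G M × (∀ v → Any (v ≡_) (endpoints M)))

-- Corona H ∘ X.  Vertex set Fin (n H + n H * n X):
-- the first n H vertices are those of H; the vertex encoding (v , x)
-- via remQuot is the copy of vertex x of X attached to vertex v of H.

private
  eqb : ∀ {m} → Fin m → Fin m → Bool
  eqb u v = does (u ≟ v)

  eqb-sym : ∀ {m} (u v : Fin m) → eqb u v ≡ eqb v u
  eqb-sym u v with u ≟ v | v ≟ u
  ... | yes _ | yes _ = refl
  ... | no _  | no _  = refl
  ... | yes p | no ¬q = Data.Empty.⊥-elim (¬q (sym p))
    where import Data.Empty
  ... | no ¬p | yes q = Data.Empty.⊥-elim (¬p (sym q))
    where import Data.Empty

coronaVertex : (H X : Graph) → Fin (n H + n H * n X) → Fin (n H) ⊎ (Fin (n H) × Fin (n X))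
coronaVertex H X i with splitAt (n H) i
... | inj₁ u = inj₁ u
... | inj₂ k = inj₂ (remQuot {n H} (n X) k)

coronaAdj' : (H X : Graph) → Fin (n H) ⊎ (Fin (n H) × Fin (n X)) →
             Fin (n H) ⊎ (Fin (n H) × Fin (n X)) → Bool
coronaAdj' H X (inj₁ u)       (inj₁ v)       = adj H u v
coronaAdj' H X (inj₁ u)       (inj₂ (v , _)) = eqb u v
coronaAdj' H X (inj₂ (u , _)) (inj₁ v)       = eqb u v
coronaAdj' H X (inj₂ (u , x)) (inj₂ (v , y)) = eqb u v ∧ adj X x y

private
  coronaAdj'-sym : ∀ H X a b → coronaAdj' H X a b ≡ coronaAdj' H X b a
  coronaAdj'-sym H X (inj₁ u) (inj₁ v) = adj-sym H u v
  coronaAdj'-sym H X (inj₁ u) (inj₂ (v , _)) = eqb-sym u v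
  coronaAdj'-sym H X (inj₂ (u , _)) (inj₁ v) = eqb-sym u v
  coronaAdj'-sym H X (inj₂ (u , x)) (inj₂ (v , y))
    rewrite eqb-sym u v | adj-sym X x y = refl

  coronaAdj'-irrefl : ∀ H X a → coronaAdj' H X a a ≡ false
  coronaAdj'-irrefl H X (inj₁ u) = adj-irrefl H u
  coronaAdj'-irrefl H X (inj₂ (u , x)) rewrite adj-irrefl X x = ∧-zeroʳ (eqb u u)

corona : Graph → Graph → Graph
corona H X = record
  { n = n H + n H * n X
  ; adj = λ i j → coronaAdj' H X (coronaVertex H X i) (coronaVertex H X j)
  ; adj-sym = λ i j → coronaAdj'-sym H X (coronaVertex H X i) (coronaVertex H X j)
  ; adj-irrefl = λ i → coronaAdj'-irrefl H X (coronaVertex H X i)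
  }

module Submission where

-- Every vertex v of H spans a block of G = H ∘ X: v itself (the hub) and its copy X_v of X; there
-- are n H blocks of n X + 1 vertices each.
--
-- (⇐) If S and M witness α(X) + μ(X) = n X and M misses a vertex u, then the copies of S in all X_v,
-- together with the copies of M and the edges v u_v, witness α(G) + μ(G) = n H (n X + 1) = n G.
--
-- (⇒) Let S and M witness α(G) + μ(G) = n G. Give block v the weight 2 |S ∩ block v| plus the number
-- of endpoints of M in the block; the weights add up to 2 (|S| + |M|) = 2 n G = n H · 2 (n X + 1).
-- The traces S↾v of S and M↾v of M on X_v are an independent set and a matching of X, and besides
-- M↾v at most one edge of M meets block v, at the hub. So a block whose hub is not in S weighs at
-- most 2 (|S↾v| + |M↾v| + 1) ≤ 2 (n X + 1), while a block whose hub is in S weighs less than that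
-- once 2 |M↾v| < n X (X has no perfect matching) and n X ≥ 2 (a one-vertex X is trivially
-- König–Egerváry). Hence every block reaches the bound and |S↾v| + |M↾v| = n X. Had X a perfect
-- matching of size p = n X / 2, every block would hold at most p vertices of S, and then
-- 2 (|S| + |M|) ≤ n H · n X + n G < 2 n G.

open import Defs
open import Data.Bool using (Bool; true; false; not; _∧_; if_then_else_)
open import Data.Bool.Properties using (∧-zeroʳ)
open import Data.Fin using (Fin; zero; suc; _≟_; fromℕ<; _↑ˡ_; _↑ʳ_; combine; splitAt)
open import Data.Fin.Properties
  using (injective⇒≤; ¬∀⟶∃¬; splitAt-↑ˡ; splitAt-↑ʳ; splitAt⁻¹-↑ʳ; remQuot-combine; combine-remQuot)
open import Data.Fin.Subset using (Subset; ∣_∣; ∁; ⊤) renaming (_∈_ to _∈ₛ_)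
open import Data.Fin.Subset.Properties using (∣p∣≤n; ∣∁p∣≡n∸∣p∣; ∣⊤∣≡n)
open import Data.List as List using (List; []; _∷_; length; map; mapMaybe)
open import Data.List.Membership.Propositional using (_∈_; _∉_)
open import Data.List.Membership.Propositional.Properties using (∈-map⁻)
open import Data.List.Properties
  using (map-cong; map-cong-local; length-++; length-map; map-tabulate; concatMap-++)
open import Data.List.Relation.Binary.Disjoint.Propositional using (Disjoint)
open import Data.List.Relation.Unary.All as All using (All; []; _∷_)
import Data.List.Relation.Unary.All.Properties as All
open import Data.List.Relation.Unary.AllPairs using ([]; _∷_)
import Data.List.Relation.Unary.AllPairs.Properties as AllPairs
open import Data.List.Relation.Unary.Any as Any using (any?; here; there)
open import Data.List.Relation.Unary.Any.Properties using (lookup-index)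
open import Data.List.Relation.Unary.Unique.Propositional using (Unique)
import Data.List.Relation.Unary.Unique.Propositional.Properties as Unique
open import Data.Maybe using (Maybe; just; nothing; zip; is-just)
open import Data.Maybe.Properties using (just-injective)
import Data.Nat as ℕ
open import Data.Nat using (ℕ; zero; suc; _+_; _*_; _∸_; _≤_; _<_; z≤n; s≤s; s≤s⁻¹)
open import Data.Nat.ListAction using (sum)
open import Data.Nat.Properties hiding (_≟_)
open import Data.Nat.Tactic.RingSolver using (solve-∀)
open import Data.Product as Product using (_×_; _,_; proj₁; proj₂; ∃-syntax; uncurry)
open import Data.Sum using (_⊎_; inj₁; inj₂)
open import Data.Vec using (tabulate; lookup)
open import Data.Vec.Properties using (tabulate∘lookup; lookup∘tabulate; lookup-map; lookup⇒[]=; []=⇒lookup)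
open import Function using (_∘_)
open import Function.Bundles using (_⇔_; mk⇔)
open import Relation.Binary.PropositionalEquality
open import Relation.Nullary using (¬_; does; yes; no; contradiction)
open import Relation.Nullary.Decidable using (dec-true)
open import Algebra.Properties.CommutativeMonoid.Sum +-0-commutativeMonoid
  using (sum-syntax; ∑-distrib-+; sum-cong-≗; sum-replicate-zero) renaming (sum to ∑)
import Algebra.Properties.CommutativeSemigroup as CommutativeSemigroup
open import Algebra.Properties.Semiring.Sum +-*-semiring using (*-distribˡ-sum)

module +-CS = CommutativeSemigroup +-commutativeSemigroup
module *-CS = CommutativeSemigroup *-commutativeSemigroup

-- Counting

𝟙 : Bool → ℕ
𝟙 true  = 1
𝟙 false = 0

∑-mono-≤ : ∀ {n} {f g : Fin n → ℕ} → (∀ i → f i ≤ g i) → ∑ f ≤ ∑ g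
∑-mono-≤ {zero}  f≤g = z≤n
∑-mono-≤ {suc n} {f} {g} f≤g =
  +-mono-≤ (f≤g zero) (∑-mono-≤ {f = f ∘ suc} {g = g ∘ suc} (f≤g ∘ suc))

∑-const : ∀ n c → ∑[ i < n ] c ≡ n * c
∑-const zero    c = refl
∑-const (suc n) c = cong (c +_) (∑-const n c)

∑-↑ : ∀ m n (f : Fin (m + n) → ℕ) → ∑ f ≡ ∑[ i < m ] f (i ↑ˡ n) + ∑[ j < n ] f (m ↑ʳ j)
∑-↑ zero    n f = refl
∑-↑ (suc m) n f = trans (cong (f zero +_) (∑-↑ m n (f ∘ suc))) (sym (+-assoc (f zero) _ _))

∑-combine : ∀ m n (f : Fin (m * n) → ℕ) → ∑ f ≡ ∑[ i < m ] ∑[ j < n ] f (combine i j)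
∑-combine zero    n f = refl
∑-combine (suc m) n f =
  trans (∑-↑ n (m * n) f) (cong (∑[ j < n ] f (j ↑ˡ m * n) +_) (∑-combine m n (λ k → f (n ↑ʳ k))))

∑-point : ∀ {n} (a : Fin n) → ∑[ i < n ] 𝟙 (does (a ≟ i)) ≡ 1
∑-point {suc n} zero    = cong suc (sum-replicate-zero n)
∑-point         (suc a) = ∑-point a

∑-point′ : ∀ {n} (a : Fin n) → ∑[ i < n ] 𝟙 (does (i ≟ a)) ≡ 1
∑-point′ {suc n} zero    = cong suc (sum-replicate-zero n)
∑-point′         (suc a) = ∑-point′ a

erase : ∀ {n} → Fin n → (Fin n → ℕ) → Fin n → ℕ
erase a f i = if does (a ≟ i) then 0 else f i

∑-erase : ∀ {n} (f : Fin n → ℕ) (a : Fin n) → ∑ f ≡ f a + ∑ (erase a f)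
∑-erase f zero    = refl
∑-erase f (suc a) = trans (cong (f zero +_) (∑-erase (f ∘ suc) a)) (+-CS.x∙yz≈y∙xz (f zero) (f (suc a)) _)

erase-≢ : ∀ {n} {a i : Fin n} (f : Fin n → ℕ) → a ≢ i → erase a f i ≡ f i
erase-≢ {a = a} {i} f a≢i with a ≟ i
... | yes a≡i = contradiction a≡i a≢i
... | no  _   = refl

n*c≤∑⇒c≤ : ∀ {n} (f : Fin n → ℕ) c → (∀ i → f i ≤ c) → n * c ≤ ∑ f → ∀ i → c ≤ f i
n*c≤∑⇒c≤ {suc n} f c f≤c n*c≤∑f zero = +-cancelʳ-≤ (n * c) c (f zero) (begin
  c + n * c               ≤⟨ n*c≤∑f ⟩
  f zero + ∑ (f ∘ suc)    ≤⟨ +-monoʳ-≤ (f zero) (∑-mono-≤ (f≤c ∘ suc)) ⟩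
  f zero + ∑[ i < n ] c   ≡⟨ cong (f zero +_) (∑-const n c) ⟩
  f zero + n * c          ∎)
  where open ≤-Reasoning
n*c≤∑⇒c≤ {suc n} f c f≤c n*c≤∑f (suc i) =
  n*c≤∑⇒c≤ (f ∘ suc) c (f≤c ∘ suc) (+-cancelˡ-≤ c _ _ (≤-trans n*c≤∑f (+-monoˡ-≤ _ (f≤c zero)))) i

∣tabulate∣≡∑ : ∀ {n} (f : Fin n → Bool) → ∣ tabulate f ∣ ≡ ∑[ i < n ] 𝟙 (f i)
∣tabulate∣≡∑ {zero}  f = refl
∣tabulate∣≡∑ {suc n} f with f zero
... | true  = cong suc (∣tabulate∣≡∑ (f ∘ suc))
... | false = ∣tabulate∣≡∑ (f ∘ suc)

∣p∣≡∑ : ∀ {n} (p : Subset n) → ∣ p ∣ ≡ ∑ (𝟙 ∘ lookup p)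
∣p∣≡∑ p = trans (cong ∣_∣ (sym (tabulate∘lookup p))) (∣tabulate∣≡∑ (lookup p))

∈tabulate⇒ : ∀ {n} {f : Fin n → Bool} {i} → i ∈ₛ tabulate f → f i ≡ true
∈tabulate⇒ {f = f} {i} i∈ = trans (sym (lookup∘tabulate f i)) ([]=⇒lookup i∈)

sum-map-1 : ∀ {A : Set} (xs : List A) → sum (map (λ _ → 1) xs) ≡ length xs
sum-map-1 []       = refl
sum-map-1 (x ∷ xs) = cong suc (sum-map-1 xs)

∑-sum-comm : ∀ {n} {A : Set} (g : Fin n → A → ℕ) (xs : List A) →
  ∑[ i < n ] sum (map (g i) xs) ≡ sum (map (λ x → ∑[ i < n ] g i x) xs)
∑-sum-comm {n} g []       = sum-replicate-zero n
∑-sum-comm     g (x ∷ xs) = trans (∑-distrib-+ (λ i → g i x) _) (cong (∑[ i < _ ] g i x +_) (∑-sum-comm g xs))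

unique⇒sum-map≤∑ : ∀ {n} (f : Fin n → ℕ) {xs} → Unique xs → sum (map f xs) ≤ ∑ f
unique⇒sum-map≤∑ f []                      = z≤n
unique⇒sum-map≤∑ f {a ∷ xs} (a∉xs ∷ !xs) = begin
  f a + sum (map f xs)           ≡⟨ cong (λ ys → f a + sum ys) (map-cong-local (All.map (erase-≢ f) a∉xs)) ⟨
  f a + sum (map (erase a f) xs) ≤⟨ +-monoʳ-≤ (f a) (unique⇒sum-map≤∑ (erase a f) !xs) ⟩
  f a + ∑ (erase a f)            ≡⟨ ∑-erase f a ⟨
  ∑ f                            ∎
  where open ≤-Reasoning

unique∧∉⇒length< : ∀ {n} {xs : List (Fin n)} {a} → Unique xs → a ∉ xs → length xs < n
unique∧∉⇒length< {n} {xs} {a} !xs a∉xs = begin-strict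
  length xs                         ≡⟨ sum-map-1 xs ⟨
  sum (map (λ _ → 1) xs)            ≡⟨ cong sum (map-cong-local (All.map (erase-≢ _) (All.¬Any⇒All¬ xs a∉xs))) ⟨
  sum (map (erase a (λ _ → 1)) xs)  ≤⟨ unique⇒sum-map≤∑ (erase a (λ _ → 1)) !xs ⟩
  ∑ (erase a (λ _ → 1))             <⟨ n<1+n _ ⟩
  1 + ∑ (erase a (λ _ → 1))         ≡⟨ ∑-erase (λ _ → 1) a ⟨
  ∑[ i < n ] 1                      ≡⟨ trans (∑-const n 1) (*-identityʳ n) ⟩
  n                                 ∎
  where open ≤-Reasoning

covering⇒≤length : ∀ {n} {xs : List (Fin n)} → (∀ i → i ∈ xs) → n ≤ length xs
covering⇒≤length {xs = xs} i∈xs = injective⇒≤ {f = λ i → Any.index (i∈xs i)} λ {i} {j} eq → begin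
  i                                    ≡⟨ lookup-index (i∈xs i) ⟩
  List.lookup xs (Any.index (i∈xs i))  ≡⟨ cong (List.lookup xs) eq ⟩
  List.lookup xs (Any.index (i∈xs j))  ≡⟨ lookup-index (i∈xs j) ⟨
  j                                    ∎
  where open ≡-Reasoning

length-concat-tabulate : ∀ {A : Set} {n} (f : Fin n → List A) c → (∀ i → length (f i) ≡ c) →
  length (List.concat (List.tabulate f)) ≡ n * c
length-concat-tabulate {n = zero}  f c _     = refl
length-concat-tabulate {n = suc n} f c ∣f∣≡c =
  trans (length-++ (f zero)) (cong₂ _+_ (∣f∣≡c zero) (length-concat-tabulate (f ∘ suc) c (∣f∣≡c ∘ suc)))

length-mapMaybe-∷ : ∀ {A B : Set} (f : A → Maybe B) x xs →
  length (mapMaybe f (x ∷ xs)) ≡ 𝟙 (is-just (f x)) + length (mapMaybe f xs)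
length-mapMaybe-∷ f x xs with f x
... | just _  = refl
... | nothing = refl

-- Matchings and independent sets

length-endpoints : ∀ {m} (M : List (Fin m × Fin m)) → length (endpoints M) ≡ 2 * length M
length-endpoints []      = refl
length-endpoints (_ ∷ M) = trans (cong (2 +_) (length-endpoints M)) (sym (*-suc 2 (length M)))

endpoints-concat : ∀ {m} (Ms : List (List (Fin m × Fin m))) →
  endpoints (List.concat Ms) ≡ List.concat (map endpoints Ms)
endpoints-concat []       = refl
endpoints-concat (M ∷ Ms) =
  trans (concatMap-++ _ M (List.concat Ms)) (cong (endpoints M List.++_) (endpoints-concat Ms))

module _ (G : Graph) where

  matching⇒2*length≤n : ∀ {M} → IsMatching G M → 2 * length M ≤ n G
  matching⇒2*length≤n {M} (_ , !M) = begin
    2 * length M                       ≡⟨ length-endpoints M ⟨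
    length (endpoints M)               ≡⟨ sum-map-1 (endpoints M) ⟨
    sum (map (λ _ → 1) (endpoints M))  ≤⟨ unique⇒sum-map≤∑ (λ _ → 1) !M ⟩
    ∑[ i < n G ] 1                     ≡⟨ trans (∑-const (n G) 1) (*-identityʳ (n G)) ⟩
    n G                                ∎
    where open ≤-Reasoning

  independent+matching≤n : ∀ {S M} → Independent G S → IsMatching G M → ∣ S ∣ + length M ≤ n G
  independent+matching≤n {S} {M} S-independent (M~ , !M) = begin
    ∣ S ∣ + length M                         ≤⟨ +-monoʳ-≤ ∣ S ∣ (length≤outside M M~) ⟩
    ∣ S ∣ + sum (map outside (endpoints M))  ≤⟨ +-monoʳ-≤ ∣ S ∣ (unique⇒sum-map≤∑ outside !M) ⟩
    ∣ S ∣ + ∑ outside                        ≡⟨ cong (∣ S ∣ +_) ∑outside≡∣∁S∣ ⟩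
    ∣ S ∣ + ∣ ∁ S ∣                          ≡⟨ cong (∣ S ∣ +_) (∣∁p∣≡n∸∣p∣ S) ⟩
    ∣ S ∣ + (n G ∸ ∣ S ∣)                    ≡⟨ m+[n∸m]≡n (∣p∣≤n S) ⟩
    n G                                      ∎
    where
    open ≤-Reasoning
    outside : Fin (n G) → ℕ
    outside i = 𝟙 (not (lookup S i))
    ∑outside≡∣∁S∣ : ∑ outside ≡ ∣ ∁ S ∣
    ∑outside≡∣∁S∣ = trans (sum-cong-≗ λ i → cong 𝟙 (sym (lookup-map i not S))) (sym (∣p∣≡∑ (∁ S)))
    edge-leaves-S : ∀ {k l} → Adj G k l → 1 ≤ outside k + outside l
    edge-leaves-S {k} {l} k~l with lookup S k in k∈S | lookup S l in l∈S
    ... | false | _     = s≤s z≤n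
    ... | true  | false = s≤s z≤n
    ... | true  | true  = contradiction
      (trans (sym k~l) (S-independent k l (lookup⇒[]= k S k∈S) (lookup⇒[]= l S l∈S))) λ ()
    length≤outside : ∀ M → All (λ { (k , l) → Adj G k l }) M → length M ≤ sum (map outside (endpoints M))
    length≤outside []            []          = z≤n
    length≤outside ((k , l) ∷ M) (k~l ∷ M~) =
      ≤-trans (+-mono-≤ (edge-leaves-S k~l) (length≤outside M M~)) (≤-reflexive (+-assoc (outside k) _ _))

  covering⇒n≤2*length : ∀ M → (∀ v → v ∈ endpoints M) → n G ≤ 2 * length M
  covering⇒n≤2*length M covers = ≤-trans (covering⇒≤length covers) (≤-reflexive (length-endpoints M))

  2*length≡n⇒perfect : ∀ {M} → IsMatching G M → 2 * length M ≡ n G → HasPerfectMatching G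
  2*length≡n⇒perfect {M} M-matching 2m≡n = M , M-matching , covers
    where
    covers : ∀ v → v ∈ endpoints M
    covers v with any? (v ≟_) (endpoints M)
    ... | yes v∈M = v∈M
    ... | no  v∉M = contradiction (trans (length-endpoints M) 2m≡n) (<⇒≢ (unique∧∉⇒length< (proj₂ M-matching) v∉M))

  ¬perfect⇒uncovered : ∀ {M} → IsMatching G M → ¬ HasPerfectMatching G → ∃[ u ] u ∉ endpoints M
  ¬perfect⇒uncovered {M} M-matching ¬perfect =
    ¬∀⟶∃¬ (n G) (_∈ endpoints M) (λ v → any? (v ≟_) (endpoints M)) (λ covers → ¬perfect (M , M-matching , covers))

  König-Egerváry-witness : ∀ {S M} → Independent G S → IsMatching G M → ∣ S ∣ + length M ≡ n G →
    KönigEgerváry G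
  König-Egerváry-witness {S} {M} S-independent M-matching S+M≡n =
    ∣ S ∣ , length M ,
    ((S , S-independent , refl) , λ S′ S′-independent → +-cancelʳ-≤ (length M) _ _
      (subst (∣ S′ ∣ + length M ≤_) (sym S+M≡n) (independent+matching≤n S′-independent M-matching))) ,
    ((M , M-matching , refl) , λ M′ M′-matching → +-cancelˡ-≤ ∣ S ∣ _ _
      (subst (∣ S ∣ + length M′ ≤_) (sym S+M≡n) (independent+matching≤n S-independent M′-matching))) ,
    S+M≡n

  single-vertex⇒König-Egerváry : n G ≡ 1 → KönigEgerváry G
  single-vertex⇒König-Egerváry n≡1 =
    König-Egerváry-witness ⊤-independent ([] , []) (trans (+-identityʳ _) (∣⊤∣≡n (n G)))
    where
    Fin1-unique : ∀ {m} → m ≡ 1 → (u v : Fin m) → u ≡ v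
    Fin1-unique refl zero zero = refl
    ⊤-independent : Independent G ⊤
    ⊤-independent u v _ _ = subst (λ w → adj G u w ≡ false) (Fin1-unique n≡1 u v) (adj-irrefl G u)

-- Induced subgraphs

record InducedEmbedding (X G : Graph) : Set where
  field
    embed          : Fin (n X) → Fin (n G)
    preimage       : Fin (n G) → Maybe (Fin (n X))
    preimage-embed : ∀ k → preimage (embed k) ≡ just k
    preimage-just  : ∀ {i k} → preimage i ≡ just k → embed k ≡ i
    adj-embed      : ∀ k l → adj G (embed k) (embed l) ≡ adj X k l

module _ {X G : Graph} (E : InducedEmbedding X G) where
  open InducedEmbedding E

  embed-injective : ∀ {k l} → embed k ≡ embed l → k ≡ l
  embed-injective {k} {l} eq =
    just-injective (trans (sym (preimage-embed k)) (trans (cong preimage eq) (preimage-embed l)))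

  restrict : Subset (n G) → Subset (n X)
  restrict S = tabulate (lookup S ∘ embed)

  restrict-independent : ∀ {S} → Independent G S → Independent X (restrict S)
  restrict-independent {S} S-independent k l k∈ l∈ = trans (sym (adj-embed k l))
    (S-independent (embed k) (embed l) (lookup⇒[]= _ S (∈tabulate⇒ k∈)) (lookup⇒[]= _ S (∈tabulate⇒ l∈)))

  embedEdges : List (Fin (n X) × Fin (n X)) → List (Fin (n G) × Fin (n G))
  embedEdges = map (Product.map embed embed)

  endpoints-embedEdges : ∀ M → endpoints (embedEdges M) ≡ map embed (endpoints M)
  endpoints-embedEdges []            = refl
  endpoints-embedEdges ((k , l) ∷ M) = cong (λ es → embed k ∷ embed l ∷ es) (endpoints-embedEdges M)

  embed-matching : ∀ {M} → IsMatching X M → IsMatching G (embedEdges M)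
  embed-matching {M} (M~ , !M) =
    embed-adjacent M M~ , subst Unique (sym (endpoints-embedEdges M)) (Unique.map⁺ embed-injective !M)
    where
    embed-adjacent : ∀ M → All (λ { (k , l) → Adj X k l }) M → All (λ { (i , j) → Adj G i j }) (embedEdges M)
    embed-adjacent []            []          = []
    embed-adjacent ((k , l) ∷ M) (k~l ∷ M~) = trans (adj-embed k l) k~l ∷ embed-adjacent M M~

  restrictEdge : Fin (n G) × Fin (n G) → Maybe (Fin (n X) × Fin (n X))
  restrictEdge (i , j) = zip (preimage i) (preimage j)

  restrictEdges : List (Fin (n G) × Fin (n G)) → List (Fin (n X) × Fin (n X))
  restrictEdges = mapMaybe restrictEdge

  restrictEdges-adjacent : ∀ M → All (λ { (i , j) → Adj G i j }) M →
    All (λ { (k , l) → Adj X k l }) (restrictEdges M)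
  restrictEdges-adjacent []            []          = []
  restrictEdges-adjacent ((i , j) ∷ M) (i~j ∷ M~) with preimage i in i↤k | preimage j in j↤l
  ... | just k  | just l  = trans (sym (adj-embed k l))
          (trans (cong₂ (adj G) (preimage-just i↤k) (preimage-just j↤l)) i~j) ∷ restrictEdges-adjacent M M~
  ... | just _  | nothing = restrictEdges-adjacent M M~
  ... | nothing | _       = restrictEdges-adjacent M M~

  ∈-restrictEdges : ∀ M {k} → k ∈ endpoints (restrictEdges M) → embed k ∈ endpoints M
  ∈-restrictEdges ((i , j) ∷ M) k∈ with preimage i in i↤k | preimage j in j↤l | k∈
  ... | just k  | just l  | here refl         = here (preimage-just i↤k)
  ... | just k  | just l  | there (here refl) = there (here (preimage-just j↤l))
  ... | just k  | just l  | there (there k∈M) = there (there (∈-restrictEdges M k∈M))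
  ... | just _  | nothing | k∈M               = there (there (∈-restrictEdges M k∈M))
  ... | nothing | _       | k∈M               = there (there (∈-restrictEdges M k∈M))

  restrictEdges-unique : ∀ M → Unique (endpoints M) → Unique (endpoints (restrictEdges M))
  restrictEdges-unique []            []                       = []
  restrictEdges-unique ((i , j) ∷ M) ((i≢j ∷ i∉M) ∷ j∉M ∷ !M) with preimage i in i↤k | preimage j in j↤l
  ... | just k  | just l  =
    (k≢l ∷ avoids i∉M (preimage-just i↤k)) ∷ avoids j∉M (preimage-just j↤l) ∷ restrictEdges-unique M !M
    where
    k≢l : k ≢ l
    k≢l k≡l = i≢j (trans (sym (preimage-just i↤k)) (trans (cong embed k≡l) (preimage-just j↤l)))
    avoids : ∀ {i k} → All (i ≢_) (endpoints M) → embed k ≡ i → All (k ≢_) (endpoints (restrictEdges M))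
    avoids i∉M k↦i = All.tabulate λ l∈ k≡l →
      All.lookup i∉M (∈-restrictEdges M l∈) (trans (sym k↦i) (cong embed k≡l))
  ... | just _  | nothing = restrictEdges-unique M !M
  ... | nothing | _       = restrictEdges-unique M !M

  restrict-matching : ∀ {M} → IsMatching G M → IsMatching X (restrictEdges M)
  restrict-matching {M} (M~ , !M) = restrictEdges-adjacent M M~ , restrictEdges-unique M !M

-- The corona

module Corona (H X : Graph) where

  G : Graph
  G = corona H X

  Vertex : Set
  Vertex = Fin (n H) ⊎ (Fin (n H) × Fin (n X))

  hub : Fin (n H) → Fin (n G)
  hub v = v ↑ˡ n H * n X

  leaf : Fin (n H) → Fin (n X) → Fin (n G)
  leaf v j = n H ↑ʳ combine v j

  decode : Fin (n G) → Vertex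
  decode = coronaVertex H X

  decode-hub : ∀ v → decode (hub v) ≡ inj₁ v
  decode-hub v rewrite splitAt-↑ˡ (n H) v (n H * n X) = refl

  decode-leaf : ∀ v j → decode (leaf v j) ≡ inj₂ (v , j)
  decode-leaf v j rewrite splitAt-↑ʳ (n H) (n H * n X) (combine v j) | remQuot-combine {n H} {n X} v j = refl

  decode⁻¹-leaf : ∀ {i v j} → decode i ≡ inj₂ (v , j) → leaf v j ≡ i
  decode⁻¹-leaf {i} eq with splitAt (n H) i in split≡
  decode⁻¹-leaf {i} refl | inj₂ k = trans (cong (n H ↑ʳ_) (combine-remQuot {n H} (n X) k)) (splitAt⁻¹-↑ʳ split≡)

  hub≢leaf : ∀ v w j → hub v ≢ leaf w j
  hub≢leaf v w j eq with trans (sym (decode-hub v)) (trans (cong decode eq) (decode-leaf w j))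
  ... | ()

  ∑-corona : (f : Fin (n G) → ℕ) → ∑ f ≡ ∑[ v < n H ] (f (hub v) + ∑[ j < n X ] f (leaf v j))
  ∑-corona f = begin
    ∑ f                                                    ≡⟨ ∑-↑ (n H) (n H * n X) f ⟩
    ∑ (f ∘ hub) + ∑[ k < n H * n X ] f (n H ↑ʳ k)          ≡⟨ cong (∑ (f ∘ hub) +_) (∑-combine (n H) (n X) _) ⟩
    ∑ (f ∘ hub) + ∑[ v < n H ] ∑[ j < n X ] f (leaf v j)    ≡⟨ ∑-distrib-+ (f ∘ hub) _ ⟨
    ∑[ v < n H ] (f (hub v) + ∑[ j < n X ] f (leaf v j))    ∎
    where open ≡-Reasoning

  adj-hub-leaf : ∀ v j → Adj G (hub v) (leaf v j)
  adj-hub-leaf v j rewrite decode-hub v | decode-leaf v j = dec-true (v ≟ v) refl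

  adj-leaf-leaf : ∀ v k l → adj G (leaf v k) (leaf v l) ≡ adj X k l
  adj-leaf-leaf v k l rewrite decode-leaf v k | decode-leaf v l | dec-true (v ≟ v) refl = refl

  leafOf : Fin (n H) → Vertex → Maybe (Fin (n X))
  leafOf v (inj₁ _)       = nothing
  leafOf v (inj₂ (u , j)) = if does (u ≟ v) then just j else nothing

  copy : Fin (n H) → InducedEmbedding X G
  copy v = record
    { embed          = leaf v
    ; preimage       = leafOf v ∘ decode
    ; preimage-embed = preimage-embed
    ; preimage-just  = preimage-just
    ; adj-embed      = adj-leaf-leaf v
    }
    where
    preimage-embed : ∀ j → leafOf v (decode (leaf v j)) ≡ just j
    preimage-embed j rewrite decode-leaf v j | dec-true (v ≟ v) refl = refl

    preimage-just : ∀ {i j} → leafOf v (decode i) ≡ just j → leaf v j ≡ i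
    preimage-just {i} i↤j with decode i in decode≡
    ... | inj₂ (u , k) with u ≟ v
    preimage-just {i} refl | inj₂ (u , k) | yes refl = decode⁻¹-leaf decode≡

  block : Vertex → Fin (n H)
  block (inj₁ v)       = v
  block (inj₂ (v , _)) = v

  inBlock : Fin (n H) → Vertex → ℕ
  inBlock v p = 𝟙 (does (block p ≟ v))

  isHub : Fin (n H) → Vertex → ℕ
  isHub v (inj₁ w) = 𝟙 (does (w ≟ v))
  isHub v (inj₂ _) = 0

  inCopy : Fin (n H) → Vertex → Vertex → ℕ
  inCopy v p q = 𝟙 (is-just (zip (leafOf v p) (leafOf v q)))

  -- The hub v is the only neighbour of X_v outside it, so an edge meeting block v either lies in X_v
  -- or has v as an endpoint.
  edge-inBlock≤ : ∀ v p q → coronaAdj' H X p q ≡ true →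
    inBlock v p + inBlock v q ≤ 2 * (inCopy v p q + (isHub v p + isHub v q))
  edge-inBlock≤ v (inj₁ u) (inj₁ w) _ = m≤m+n _ _
  edge-inBlock≤ v (inj₁ u) (inj₂ (w , l)) u~w with u ≟ w
  edge-inBlock≤ v (inj₁ u) (inj₂ (u , l)) _ | yes refl with u ≟ v
  ... | yes _ = ≤-refl
  ... | no  _ = z≤n
  edge-inBlock≤ v (inj₂ (u , k)) (inj₁ w) u~w with u ≟ w
  edge-inBlock≤ v (inj₂ (u , k)) (inj₁ u) _ | yes refl with u ≟ v
  ... | yes _ = ≤-refl
  ... | no  _ = z≤n
  edge-inBlock≤ v (inj₂ (u , k)) (inj₂ (w , l)) u~w with u ≟ w
  edge-inBlock≤ v (inj₂ (u , k)) (inj₂ (u , l)) _ | yes refl with u ≟ v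
  ... | yes _ = ≤-refl
  ... | no  _ = z≤n

  endpoints-inBlock≤ : ∀ v M → All (λ { (i , j) → Adj G i j }) M →
    sum (map (inBlock v ∘ decode) (endpoints M)) ≤
    2 * (length (restrictEdges (copy v) M) + sum (map (isHub v ∘ decode) (endpoints M)))
  endpoints-inBlock≤ v []            []          = z≤n
  endpoints-inBlock≤ v ((i , j) ∷ M) (i~j ∷ M~) = begin
    a + (b + rest)                  ≡⟨ +-assoc a b rest ⟨
    (a + b) + rest                  ≤⟨ +-mono-≤ (edge-inBlock≤ v (decode i) (decode j) i~j) (endpoints-inBlock≤ v M M~) ⟩
    2 * (e + (c + d)) + 2 * (L + h) ≡⟨ *-distribˡ-+ 2 (e + (c + d)) (L + h) ⟨
    2 * ((e + (c + d)) + (L + h))   ≡⟨ cong (2 *_) (trans (+-CS.interchange e (c + d) L h) (cong (e + L +_) (+-assoc c d h))) ⟩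
    2 * ((e + L) + (c + (d + h)))   ≡⟨ cong (λ m → 2 * (m + (c + (d + h)))) (length-mapMaybe-∷ (restrictEdge (copy v)) (i , j) M) ⟨
    2 * (length (restrictEdges (copy v) ((i , j) ∷ M)) + (c + (d + h))) ∎
    where
    open ≤-Reasoning
    a = inBlock v (decode i)
    b = inBlock v (decode j)
    c = isHub v (decode i)
    d = isHub v (decode j)
    e = inCopy v (decode i) (decode j)
    rest = sum (map (inBlock v ∘ decode) (endpoints M))
    L = length (restrictEdges (copy v) M)
    h = sum (map (isHub v ∘ decode) (endpoints M))

module Extension (H X : Graph) {S : Subset (n X)} {M : List (Fin (n X) × Fin (n X))}
  (S-independent : Independent X S) (M-matching : IsMatching X M) (u : Fin (n X)) (u∉M : u ∉ endpoints M)
  where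
  open Corona H X

  inS-copy : Vertex → Bool
  inS-copy (inj₁ _)       = false
  inS-copy (inj₂ (_ , j)) = lookup S j

  S-copies : Subset (n G)
  S-copies = tabulate (inS-copy ∘ decode)

  ∣S-copies∣ : ∣ S-copies ∣ ≡ n H * ∣ S ∣
  ∣S-copies∣ = begin
    ∣ S-copies ∣                ≡⟨ ∣tabulate∣≡∑ (inS-copy ∘ decode) ⟩
    ∑ (𝟙 ∘ inS-copy ∘ decode)   ≡⟨ ∑-corona _ ⟩
    ∑[ v < n H ] (𝟙 (inS-copy (decode (hub v))) + ∑[ j < n X ] 𝟙 (inS-copy (decode (leaf v j))))
      ≡⟨ sum-cong-≗ (λ v → cong₂ _+_ (cong (𝟙 ∘ inS-copy) (decode-hub v))
           (trans (sum-cong-≗ λ j → cong (𝟙 ∘ inS-copy) (decode-leaf v j)) (sym (∣p∣≡∑ S)))) ⟩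
    ∑[ v < n H ] ∣ S ∣          ≡⟨ ∑-const (n H) ∣ S ∣ ⟩
    n H * ∣ S ∣                 ∎
    where open ≡-Reasoning

  S-copies-independent : Independent G S-copies
  S-copies-independent i j i∈ j∈ = independent (decode i) (decode j) (∈tabulate⇒ i∈) (∈tabulate⇒ j∈)
    where
    independent : ∀ p q → inS-copy p ≡ true → inS-copy q ≡ true → coronaAdj' H X p q ≡ false
    independent (inj₂ (v , k)) (inj₂ (w , l)) k∈S l∈S =
      trans (cong (_ ∧_) (S-independent k l (lookup⇒[]= k S k∈S) (lookup⇒[]= l S l∈S))) (∧-zeroʳ _)

  M-block : Fin (n H) → List (Fin (n G) × Fin (n G))
  M-block v = (hub v , leaf v u) ∷ embedEdges (copy v) M

  M-extended : List (Fin (n G) × Fin (n G))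
  M-extended = List.concat (List.tabulate M-block)

  length-M-extended : length M-extended ≡ n H * suc (length M)
  length-M-extended = length-concat-tabulate M-block (suc (length M)) (λ v → cong suc (length-map _ M))

  ∈copy-endpoints : ∀ v {i} → i ∈ endpoints (embedEdges (copy v) M) → ∃[ j ] (j ∈ endpoints M × i ≡ leaf v j)
  ∈copy-endpoints v i∈ = ∈-map⁻ (leaf v) (subst (_ ∈_) (endpoints-embedEdges (copy v) M) i∈)

  M-block-unique : ∀ v → Unique (endpoints (M-block v))
  M-block-unique v =
    (hub≢leaf v v u ∷ All.tabulate hub∉) ∷ All.tabulate leaf-u∉ ∷ proj₂ (embed-matching (copy v) M-matching)
    where
    hub∉ : ∀ {i} → i ∈ endpoints (embedEdges (copy v) M) → hub v ≢ i
    hub∉ i∈ with ∈copy-endpoints v i∈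
    ... | j , _ , refl = hub≢leaf v v j
    leaf-u∉ : ∀ {i} → i ∈ endpoints (embedEdges (copy v) M) → leaf v u ≢ i
    leaf-u∉ i∈ with ∈copy-endpoints v i∈
    ... | j , j∈M , refl = λ u↦j → u∉M (subst (_∈ endpoints M) (sym (embed-injective (copy v) u↦j)) j∈M)

  M-block-in-block : ∀ v {i} → i ∈ endpoints (M-block v) → block (decode i) ≡ v
  M-block-in-block v (here refl)         = cong block (decode-hub v)
  M-block-in-block v (there (here refl)) = cong block (decode-leaf v u)
  M-block-in-block v (there (there i∈)) with ∈copy-endpoints v i∈
  ... | j , _ , refl = cong block (decode-leaf v j)

  M-extended-matching : IsMatching G M-extended
  M-extended-matching =
    All.concat⁺ (All.tabulate⁺ λ v → adj-hub-leaf v u ∷ proj₁ (embed-matching (copy v) M-matching)) ,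
    subst Unique (sym endpoints-M-extended)
      (Unique.concat⁺ (All.tabulate⁺ M-block-unique) (AllPairs.tabulate⁺ disjoint))
    where
    endpoints-M-extended : endpoints M-extended ≡ List.concat (List.tabulate (endpoints ∘ M-block))
    endpoints-M-extended =
      trans (endpoints-concat (List.tabulate M-block)) (cong List.concat (map-tabulate M-block endpoints))
    disjoint : ∀ {v w} → v ≢ w → Disjoint (endpoints (M-block v)) (endpoints (M-block w))
    disjoint {v} {w} v≢w (i∈v , i∈w) = v≢w (trans (sym (M-block-in-block v i∈v)) (M-block-in-block w i∈w))

  extension-König-Egerváry : ∣ S ∣ + length M ≡ n X → KönigEgerváry G
  extension-König-Egerváry S+M≡x = König-Egerváry-witness G S-copies-independent M-extended-matching (begin
    ∣ S-copies ∣ + length M-extended   ≡⟨ cong₂ _+_ ∣S-copies∣ length-M-extended ⟩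
    n H * ∣ S ∣ + n H * suc (length M) ≡⟨ *-distribˡ-+ (n H) ∣ S ∣ (suc (length M)) ⟨
    n H * (∣ S ∣ + suc (length M))     ≡⟨ cong (n H *_) (trans (+-suc ∣ S ∣ (length M)) (cong suc S+M≡x)) ⟩
    n H * suc (n X)                    ≡⟨ *-suc (n H) (n X) ⟩
    n G                                ∎)
    where open ≡-Reasoning

module Restriction (H X : Graph) {S : Subset (n (corona H X))}
  {M : List (Fin (n (corona H X)) × Fin (n (corona H X)))}
  (S-independent : Independent (corona H X) S) (M-matching : IsMatching (corona H X) M)
  where
  open Corona H X

  S↾ : Fin (n H) → Subset (n X)
  S↾ v = restrict (copy v) S

  M↾ : Fin (n H) → List (Fin (n X) × Fin (n X))
  M↾ v = restrictEdges (copy v) M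

  S↾-independent : ∀ v → Independent X (S↾ v)
  S↾-independent v = restrict-independent (copy v) S-independent

  M↾-matching : ∀ v → IsMatching X (M↾ v)
  M↾-matching v = restrict-matching (copy v) M-matching

  ∣S↾∣+∣M↾∣≤n : ∀ v → ∣ S↾ v ∣ + length (M↾ v) ≤ n X
  ∣S↾∣+∣M↾∣≤n v = independent+matching≤n X (S↾-independent v) (M↾-matching v)

  S-in-block : Fin (n H) → ℕ
  S-in-block v = 𝟙 (lookup S (hub v)) + ∣ S↾ v ∣

  ∣S∣≡∑S-in-block : ∣ S ∣ ≡ ∑ S-in-block
  ∣S∣≡∑S-in-block = trans (∣p∣≡∑ S) (trans (∑-corona (𝟙 ∘ lookup S))
    (sum-cong-≗ λ v → cong (𝟙 (lookup S (hub v)) +_) (sym (∣tabulate∣≡∑ (lookup S ∘ leaf v)))))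

  hub∈S⇒∣S↾∣≡0 : ∀ v → lookup S (hub v) ≡ true → ∣ S↾ v ∣ ≡ 0
  hub∈S⇒∣S↾∣≡0 v hub∈S =
    trans (∣tabulate∣≡∑ (lookup S ∘ leaf v)) (trans (sum-cong-≗ leaf∉S) (sum-replicate-zero (n X)))
    where
    leaf∉S : ∀ j → 𝟙 (lookup S (leaf v j)) ≡ 0
    leaf∉S j with lookup S (leaf v j) in leaf∈S
    ... | false = refl
    ... | true  = contradiction
      (trans (sym (adj-hub-leaf v j)) (S-independent _ _ (lookup⇒[]= _ S hub∈S) (lookup⇒[]= _ S leaf∈S))) λ ()

  no-perfect-matching : 1 ≤ n H → 1 ≤ n X → ∣ S ∣ + length M ≡ n G → ¬ HasPerfectMatching X
  no-perfect-matching h≥1 x≥1 S+M≡n (P , P-matching , covers) = m<n⇒n≢0 h≥1 (n≤0⇒n≡0 h≤0)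
    where
    p = length P
    x≤2p : n X ≤ 2 * p
    x≤2p = covering⇒n≤2*length X P covers
    S-in-block≤p : ∀ v → S-in-block v ≤ p
    S-in-block≤p v with lookup S (hub v) in hub∈S
    ... | true  = subst (λ a → 1 + a ≤ p) (sym (hub∈S⇒∣S↾∣≡0 v hub∈S))
                    (n≢0⇒n>0 λ p≡0 → <⇒≱ x≥1 (subst (λ q → n X ≤ 2 * q) p≡0 x≤2p))
    ... | false = +-cancelʳ-≤ p _ p (begin
      ∣ S↾ v ∣ + p  ≤⟨ independent+matching≤n X (S↾-independent v) P-matching ⟩
      n X           ≤⟨ x≤2p ⟩
      2 * p         ≡⟨ cong (p +_) (+-identityʳ p) ⟩
      p + p         ∎)
      where open ≤-Reasoning
    2∣S∣≤hx : 2 * ∣ S ∣ ≤ n H * n X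
    2∣S∣≤hx = begin
      2 * ∣ S ∣            ≡⟨ cong (2 *_) ∣S∣≡∑S-in-block ⟩
      2 * ∑ S-in-block     ≤⟨ *-monoʳ-≤ 2 (∑-mono-≤ S-in-block≤p) ⟩
      2 * ∑[ v < n H ] p   ≡⟨ cong (2 *_) (∑-const (n H) p) ⟩
      2 * (n H * p)        ≡⟨ *-CS.x∙yz≈y∙xz 2 (n H) p ⟩
      n H * (2 * p)        ≤⟨ *-monoʳ-≤ (n H) (matching⇒2*length≤n X P-matching) ⟩
      n H * n X            ∎
      where open ≤-Reasoning
    h≤0 : n H ≤ 0
    h≤0 = +-cancelʳ-≤ (n H * n X + n G) (n H) 0 (begin
      n H + (n H * n X + n G)   ≡⟨ +-assoc (n H) (n H * n X) (n G) ⟨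
      n G + n G                 ≡⟨ cong (n G +_) (+-identityʳ (n G)) ⟨
      2 * n G                   ≡⟨ cong (2 *_) S+M≡n ⟨
      2 * (∣ S ∣ + length M)    ≡⟨ *-distribˡ-+ 2 ∣ S ∣ (length M) ⟩
      2 * ∣ S ∣ + 2 * length M  ≤⟨ +-mono-≤ 2∣S∣≤hx (matching⇒2*length≤n G M-matching) ⟩
      n H * n X + n G           ∎)
      where open ≤-Reasoning

  M-in-block : Fin (n H) → ℕ
  M-in-block v = sum (map (inBlock v ∘ decode) (endpoints M))

  ∑M-in-block≡2*length : ∑ M-in-block ≡ 2 * length M
  ∑M-in-block≡2*length = begin
    ∑ M-in-block                                                      ≡⟨ ∑-sum-comm (λ v → inBlock v ∘ decode) (endpoints M) ⟩
    sum (map (λ i → ∑[ v < n H ] inBlock v (decode i)) (endpoints M)) ≡⟨ cong sum (map-cong (∑-point ∘ block ∘ decode) (endpoints M)) ⟩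
    sum (map (λ _ → 1) (endpoints M))                                 ≡⟨ sum-map-1 (endpoints M) ⟩
    length (endpoints M)                                              ≡⟨ length-endpoints M ⟩
    2 * length M                                                      ∎
    where open ≡-Reasoning

  hub-occurrences≤1 : ∀ v → sum (map (isHub v ∘ decode) (endpoints M)) ≤ 1
  hub-occurrences≤1 v = ≤-trans (unique⇒sum-map≤∑ (isHub v ∘ decode) (proj₂ M-matching)) (≤-reflexive (begin
    ∑ (isHub v ∘ decode)                                                              ≡⟨ ∑-corona (isHub v ∘ decode) ⟩
    ∑[ w < n H ] (isHub v (decode (hub w)) + ∑[ j < n X ] isHub v (decode (leaf w j))) ≡⟨ sum-cong-≗ hub-only ⟩
    ∑[ w < n H ] 𝟙 (does (w ≟ v))                                                      ≡⟨ ∑-point′ v ⟩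
    1                                                                                  ∎))
    where
    open ≡-Reasoning
    hub-only : ∀ w → isHub v (decode (hub w)) + ∑[ j < n X ] isHub v (decode (leaf w j)) ≡ 𝟙 (does (w ≟ v))
    hub-only w rewrite decode-hub w = trans
      (cong (_ +_) (trans (sum-cong-≗ λ j → cong (isHub v) (decode-leaf w j)) (sum-replicate-zero (n X))))
      (+-identityʳ _)

  M-in-block≤ : ∀ v → M-in-block v ≤ 2 * suc (length (M↾ v))
  M-in-block≤ v = ≤-trans (endpoints-inBlock≤ v M (proj₁ M-matching))
    (*-monoʳ-≤ 2 (≤-trans (+-monoʳ-≤ _ (hub-occurrences≤1 v)) (≤-reflexive (+-comm _ 1))))

  blockWeight : Fin (n H) → ℕ
  blockWeight v = 2 * S-in-block v + M-in-block v

  ∑blockWeight : ∣ S ∣ + length M ≡ n G → ∑ blockWeight ≡ n H * (2 * suc (n X))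
  ∑blockWeight S+M≡n = begin
    ∑ blockWeight                                   ≡⟨ ∑-distrib-+ (λ v → 2 * S-in-block v) M-in-block ⟩
    ∑ (λ v → 2 * S-in-block v) + ∑ M-in-block
      ≡⟨ cong₂ _+_ (trans (cong (2 *_) ∣S∣≡∑S-in-block) (*-distribˡ-sum 2 S-in-block)) (sym ∑M-in-block≡2*length) ⟨
    2 * ∣ S ∣ + 2 * length M                        ≡⟨ *-distribˡ-+ 2 ∣ S ∣ (length M) ⟨
    2 * (∣ S ∣ + length M)                          ≡⟨ cong (2 *_) (trans S+M≡n (sym (*-suc (n H) (n X)))) ⟩
    2 * (n H * suc (n X))                           ≡⟨ *-CS.x∙yz≈y∙xz 2 (n H) (suc (n X)) ⟩
    n H * (2 * suc (n X))                           ∎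
    where open ≡-Reasoning

  hub-free-blockWeight≤ : ∀ v → lookup S (hub v) ≡ false → blockWeight v ≤ 2 * suc (∣ S↾ v ∣ + length (M↾ v))
  hub-free-blockWeight≤ v hub∉S = begin
    blockWeight v                                ≡⟨ cong (λ b → 2 * (𝟙 b + ∣ S↾ v ∣) + M-in-block v) hub∉S ⟩
    2 * ∣ S↾ v ∣ + M-in-block v                  ≤⟨ +-monoʳ-≤ (2 * ∣ S↾ v ∣) (M-in-block≤ v) ⟩
    2 * ∣ S↾ v ∣ + 2 * suc (length (M↾ v))       ≡⟨ *-distribˡ-+ 2 ∣ S↾ v ∣ _ ⟨
    2 * (∣ S↾ v ∣ + suc (length (M↾ v)))         ≡⟨ cong (2 *_) (+-suc ∣ S↾ v ∣ _) ⟩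
    2 * suc (∣ S↾ v ∣ + length (M↾ v))           ∎
    where open ≤-Reasoning

  module _ (¬perfect : ¬ HasPerfectMatching X) (x≥2 : 2 ≤ n X) where

    2*∣M↾∣<n : ∀ v → 2 * length (M↾ v) < n X
    2*∣M↾∣<n v = ≤∧≢⇒< (matching⇒2*length≤n X (M↾-matching v)) (¬perfect ∘ 2*length≡n⇒perfect X (M↾-matching v))

    hub-blockWeight< : ∀ v → lookup S (hub v) ≡ true → blockWeight v < 2 * suc (n X)
    hub-blockWeight< v hub∈S = begin-strict
      blockWeight v          ≡⟨ cong₂ (λ b a → 2 * (𝟙 b + a) + M-in-block v) hub∈S (hub∈S⇒∣S↾∣≡0 v hub∈S) ⟩
      2 + M-in-block v       ≤⟨ +-monoʳ-≤ 2 (M-in-block≤ v) ⟩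
      2 + 2 * suc m          ≡⟨ 2+2*[1+m]≡ m ⟩
      suc (suc (2 * m) + 2)  ≤⟨ s≤s (+-mono-≤ (2*∣M↾∣<n v) x≥2) ⟩
      suc (n X + n X)        <⟨ n<1+n _ ⟩
      suc (suc (n X + n X))  ≡⟨ 2+x+x≡2*[1+x] (n X) ⟩
      2 * suc (n X)          ∎
      where
      open ≤-Reasoning
      m = length (M↾ v)
      2+2*[1+m]≡ : ∀ m → 2 + 2 * suc m ≡ suc (suc (2 * m) + 2)
      2+2*[1+m]≡ = solve-∀
      2+x+x≡2*[1+x] : ∀ x → suc (suc (x + x)) ≡ 2 * suc x
      2+x+x≡2*[1+x] = solve-∀

    blockWeight≤ : ∀ v → blockWeight v ≤ 2 * suc (n X)
    blockWeight≤ v = by-hub (lookup S (hub v)) refl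
      where
      by-hub : ∀ b → lookup S (hub v) ≡ b → blockWeight v ≤ 2 * suc (n X)
      by-hub true  hub∈S = <⇒≤ (hub-blockWeight< v hub∈S)
      by-hub false hub∉S = ≤-trans (hub-free-blockWeight≤ v hub∉S) (*-monoʳ-≤ 2 (s≤s (∣S↾∣+∣M↾∣≤n v)))

    saturated⇒∣S↾∣+∣M↾∣≡n : ∀ v → 2 * suc (n X) ≤ blockWeight v → ∣ S↾ v ∣ + length (M↾ v) ≡ n X
    saturated⇒∣S↾∣+∣M↾∣≡n v saturated = by-hub (lookup S (hub v)) refl
      where
      by-hub : ∀ b → lookup S (hub v) ≡ b → ∣ S↾ v ∣ + length (M↾ v) ≡ n X
      by-hub true  hub∈S = contradiction saturated (<⇒≱ (hub-blockWeight< v hub∈S))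
      by-hub false hub∉S = ≤-antisym (∣S↾∣+∣M↾∣≤n v)
        (s≤s⁻¹ (*-cancelˡ-≤ 2 (≤-trans saturated (hub-free-blockWeight≤ v hub∉S))))

    every-block-saturated : ∣ S ∣ + length M ≡ n G → ∀ v → ∣ S↾ v ∣ + length (M↾ v) ≡ n X
    every-block-saturated S+M≡n v = saturated⇒∣S↾∣+∣M↾∣≡n v
      (n*c≤∑⇒c≤ blockWeight (2 * suc (n X)) blockWeight≤ (≤-reflexive (sym (∑blockWeight S+M≡n))) v)

corona-König-Egerváry⇒ : ∀ H X → 1 ≤ n H → 1 ≤ n X → KönigEgerváry (corona H X) →
  KönigEgerváry X × ¬ HasPerfectMatching X
corona-König-Egerváry⇒ H X h≥1 x≥1 (_ , _ , ((S , S-indep , refl) , _) , ((M , M-matching , refl) , _) , S+M≡n) =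
  X-König-Egerváry , ¬perfect
  where
  open Restriction H X S-indep M-matching
  ¬perfect : ¬ HasPerfectMatching X
  ¬perfect = no-perfect-matching h≥1 x≥1 S+M≡n
  v : Fin (n H)
  v = fromℕ< h≥1
  X-König-Egerváry : KönigEgerváry X
  X-König-Egerváry with n X ℕ.≟ 1
  ... | yes x≡1 = single-vertex⇒König-Egerváry X x≡1
  ... | no  x≢1 = König-Egerváry-witness X (S↾-independent v) (M↾-matching v)
    (every-block-saturated ¬perfect (≤∧≢⇒< x≥1 (x≢1 ∘ sym)) S+M≡n v)

König-Egerváry⇒corona-König-Egerváry : ∀ H X → KönigEgerváry X → ¬ HasPerfectMatching X →
  KönigEgerváry (corona H X)
König-Egerváry⇒corona-König-Egerváry H X (_ , _ , ((S , S-indep , refl) , _) , ((M , M-matching , refl) , _) , S+M≡x) ¬perfect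
  with u , u∉M ← ¬perfect⇒uncovered X M-matching ¬perfect =
  Extension.extension-König-Egerváry H X S-indep M-matching u u∉M S+M≡x

corollary2p3 : (H X : Graph) → 1 ≤ n H → 1 ≤ n X →
    KönigEgerváry (corona H X) ⇔ (KönigEgerváry X × ¬ HasPerfectMatching X)
corollary2p3 H X h≥1 x≥1 =
  mk⇔ (corona-König-Egerváry⇒ H X h≥1 x≥1) (uncurry (König-Egerváry⇒corona-König-Egerváry H X))
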